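{- Let $r\ge 3$. If $k\in\{3,5\}$, then $k\text{ - }\mathrm{gp_e}(\mathrm{BN}(r))=(k-1)\cdot 2^{r+1}$.
   Context: For $r\ge 3$, the $r$-dimensional Benes network $\mathrm{BN}(r)$ has vertex set $\{[s,i]: s\in\{0,1\}^r,\ i\in\{0,1,\ldots,2r\}\}$ ($i$ is the level of $[s,i]$). All edges join consecutive levels. For $1\le i\le r$, the vertex $[s,i-1]$ is adjacent to $[s',i]$ iff $s'=s$ or $s'$ differs from $s$ exactly in the $i$-th bit. For $r+1\le i\le 2r$, the vertex $[s,i-1]$ is adjacent to $[s',i]$ iff $s'=s$ or $s'$ differs from $s$ exactly in the $(2r+1-i)$-th bit. A geodesic is a shortest path. An edge $k$-general position set of a graph $G$ is a set $S\subseteq E(G)$ with $|S\cap E(P)|\le k-1$ for every geodesic $P$ of $G$; $k\text{ - }\mathrm{gp_e}(G)$ is the maximum cardinality of such a set. -}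

module Defs where

open import Data.Bool using (Bool; if_then_else_)
open import Data.Nat using (ℕ; zero; suc; _+_; _*_; _∸_; _^_; _≤_; _≤ᵇ_)
open import Data.Nat.Properties using () renaming (_≟_ to _≟ℕ_)
open import Data.Fin using (Fin; toℕ)
import Data.Fin.Properties as FinP
open import Data.Vec using (Vec; lookup)
import Data.Vec.Properties as VecP
import Data.Bool.Properties as BoolP
open import Data.List using (List; []; _∷_; length; filter; head; last)
open import Data.List.Relation.Unary.All using (All)
open import Data.List.Relation.Unary.Unique.Propositional using (Unique)
open import Data.Product using (_×_; _,_; Σ; swap)
import Data.Product
import Data.Empty
import Data.Unit
import Relation.Nullary
import Data.Product.Properties as ProdP
open import Data.Sum using (_⊎_)
open import Relation.Binary.PropositionalEquality using (_≡_; _≢_)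
open import Relation.Binary.Definitions using (DecidableEquality)
open import Relation.Nullary.Decidable using (_⊎-dec_)
import Data.List.Membership.DecPropositional as DecMem

-- Vertex [s , i] : s ∈ {0,1}^r (bit p+1 is `lookup s p`), level i ∈ {0,…,2r}.
BNVertex : ℕ → Set
BNVertex r = Vec Bool r × Fin (suc (2 * r))

DiffersExactlyAt : ∀ {r} → Vec Bool r → Vec Bool r → ℕ → Set
DiffersExactlyAt {r} s s' b =
  (p : Fin r) → (suc (toℕ p) ≡ b → lookup s p ≢ lookup s' p)
              × (suc (toℕ p) ≢ b → lookup s p ≡ lookup s' p)

-- Bit used between levels i-1 and i (1 ≤ i ≤ 2r):
--   i            if i ≤ r,
--   2r + 1 - i   if r+1 ≤ i ≤ 2r.
bitIndex : ℕ → ℕ → ℕ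
bitIndex r i = if i ≤ᵇ r then i else (2 * r + 1) ∸ i

BNDown : (r : ℕ) → BNVertex r → BNVertex r → Set
BNDown r (s , i) (s' , j) =
  (toℕ j ≡ suc (toℕ i)) × (s' ≡ s ⊎ DiffersExactlyAt s s' (bitIndex r (toℕ j)))

BNAdj : (r : ℕ) → BNVertex r → BNVertex r → Set
BNAdj r u v = BNDown r u v ⊎ BNDown r v u

IsWalk : (r : ℕ) → List (BNVertex r) → Set
IsWalk r [] = Data.Empty.⊥
IsWalk r (u ∷ []) = Data.Unit.⊤
IsWalk r (u ∷ v ∷ rest) = BNAdj r u v × IsWalk r (v ∷ rest)

walkLength : ∀ {A : Set} → List A → ℕ
walkLength xs = length xs ∸ 1

-- A geodesic: a walk between its endpoints of minimum length among all
-- walks with the same endpoints (such a walk is necessarily a path).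
IsGeodesic : (r : ℕ) → List (BNVertex r) → Set
IsGeodesic r P =
  IsWalk r P ×
  ((Q : List (BNVertex r)) → IsWalk r Q → head Q ≡ head P → last Q ≡ last P →
     walkLength P ≤ walkLength Q)

consecutive : ∀ {A : Set} → List A → List (A × A)
consecutive [] = []
consecutive (u ∷ []) = []
consecutive (u ∷ v ∷ rest) = (u , v) ∷ consecutive (v ∷ rest)

-- An edge of BN(r) is represented canonically by the ordered pair
-- (lower endpoint , upper endpoint) satisfying BNDown.
-- An edge set is a duplicate-free list of such pairs.

bnVertex-≟ : (r : ℕ) → DecidableEquality (BNVertex r)
bnVertex-≟ r = ProdP.≡-dec (VecP.≡-dec BoolP._≟_) FinP._≟_

pair-≟ : (r : ℕ) → DecidableEquality (BNVertex r × BNVertex r)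
pair-≟ r = ProdP.≡-dec (bnVertex-≟ r) (bnVertex-≟ r)

onWalk? : (r : ℕ) → (P : List (BNVertex r)) → (e : BNVertex r × BNVertex r) →
  Relation.Nullary.Dec
    (DecMem._∈_ (pair-≟ r) e (consecutive P) ⊎ DecMem._∈_ (pair-≟ r) (swap e) (consecutive P))
onWalk? r P e = DecMem._∈?_ (pair-≟ r) e (consecutive P) ⊎-dec DecMem._∈?_ (pair-≟ r) (swap e) (consecutive P)

edgesOnWalk : (r : ℕ) → List (BNVertex r × BNVertex r) → List (BNVertex r) → ℕ
edgesOnWalk r S P = length (filter (onWalk? r P) S)

IsEdgeSet : (r : ℕ) → List (BNVertex r × BNVertex r) → Set
IsEdgeSet r S = All (λ e → BNDown r (Data.Product.proj₁ e) (Data.Product.proj₂ e)) S × Unique S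

IsEdgeGP : (r k : ℕ) → List (BNVertex r × BNVertex r) → Set
IsEdgeGP r k S =
  IsEdgeSet r S ×
  ((P : List (BNVertex r)) → IsGeodesic r P → edgesOnWalk r S P ≤ k ∸ 1)

EdgeGPNumberIs : (r k m : ℕ) → Set
EdgeGPNumberIs r k m =
  Σ (List (BNVertex r × BNVertex r)) (λ S → IsEdgeGP r k S × length S ≡ m)
  × ((S : List (BNVertex r × BNVertex r)) → IsEdgeGP r k S → length S ≤ m)

-- Bit b is flipped only across the two layers i-1|i with b = i or b = 2r+1-i; they cut the levels
-- into a low, a middle and a high zone.  A walk crossing these layers three times can be shortened
-- by two steps without losing any bit it flips: of the two loops between the crossings one stays in
-- the middle zone and the other outside it, and they can be replayed in the opposite order, the
-- outer loop reflected through level r if it ends up on the wrong side.  So a geodesic uses at most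
-- two edges of these layers, and the 2 * 2^(r+1) edges carrying bit r (together with those carrying
-- bit 1, when k = 5) form an edge k-general position set of the claimed size.  Conversely the
-- 2^(r+1) paths from level 0 to level 2r that either keep their vector or flip at every step are
-- geodesics covering every edge, and each meets an edge k-general position set at most k-1 times.

module Submission where

open import Defs
open import Data.Nat using (ℕ; _≤_; _∸_; _*_; _^_; _+_)
open import Data.Sum using (_⊎_)
open import Relation.Binary.PropositionalEquality using (_≡_)

open import Data.Bool using (Bool; true; false; not; if_then_else_; T)
import Data.Bool.Properties as Boolₚ
open import Data.Empty using (⊥-elim)
open import Data.Fin as Fin using (Fin; toℕ; fromℕ; fromℕ<; inject₁)
import Data.Fin.Properties as Finₚ
open import Data.List using (List; []; _∷_; _++_; length; filter; map; concatMap; head; last; tabulate)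
import Data.List.Properties as Listₚ
open import Data.List.Membership.Propositional using (_∈_)
open import Data.List.Membership.Propositional.Properties
  using (∈-++⁺ˡ; ∈-++⁺ʳ; ∈-++⁻; ∈-map⁺; ∈-map⁻; ∈-filter⁺; ∈-filter⁻; ∈-concat⁺′)
open import Data.List.Relation.Binary.Disjoint.Propositional using (Disjoint)
open import Data.List.Relation.Binary.Subset.Propositional using (_⊆_)
open import Data.List.Relation.Binary.Subset.Propositional.Properties using (++⁺ʳ)
open import Data.List.Relation.Unary.All as All using (All; []; _∷_)
import Data.List.Relation.Unary.Any as Any
import Data.List.Relation.Unary.All.Properties as Allₚ
open import Data.List.Relation.Unary.Any using (here; there)
open import Data.List.Relation.Unary.AllPairs using ([]; _∷_)
open import Data.List.Relation.Unary.Unique.Propositional using (Unique)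
import Data.List.Relation.Unary.Unique.Propositional.Properties as Uniqueₚ
open import Data.Maybe using (just)
import Data.Maybe.Properties as Maybeₚ
open import Data.Nat using (zero; suc; _<_; z≤n; s≤s; s≤s⁻¹; _≡ᵇ_; _≤ᵇ_; _<?_; _≤?_)
open import Data.Nat.Properties
open import Data.Nat.Tactic.RingSolver using (solve-∀)
open import Data.Product using (Σ-syntax; ∃₂; _×_; _,_; -,_; proj₁; proj₂; uncurry)
open import Data.Sum using (inj₁; inj₂)
open import Data.Vec as Vec using (Vec; lookup)
import Data.Vec.Properties as Vecₚ
open import Data.Vec.Relation.Binary.Pointwise.Extensional using (ext; Pointwise-≡⇒≡)
open import Function using (_∘_)
open import Relation.Binary.Construct.Closure.ReflexiveTransitive using (Star; ε; _◅_; _◅◅_; gmap)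
open import Relation.Binary.Definitions using (DecidableEquality)
open import Relation.Binary.PropositionalEquality
  using (_≢_; refl; sym; trans; cong; cong₂; subst; subst₂; module ≡-Reasoning)
open import Relation.Nullary using (Dec; yes; no; does; ¬?)
open import Relation.Nullary.Reflects using (ofʸ; ofⁿ)
open import Relation.Unary using (Pred; Decidable)

module _ {A : Set} (_≟_ : DecidableEquality A) where

  unique-⊆⇒length-≤ : ∀ {xs ys : List A} → Unique xs → xs ⊆ ys → length xs ≤ length ys
  unique-⊆⇒length-≤ {[]} _ _ = z≤n
  unique-⊆⇒length-≤ {x ∷ xs} {ys} (x∉xs ∷ xs!) x∷xs⊆ys = begin
    suc (length xs)                    ≤⟨ s≤s (unique-⊆⇒length-≤ xs! xs⊆ys-x) ⟩
    suc (length (filter (≢x? ) ys))    ≤⟨ Listₚ.filter-notAll ≢x? ys (Any.map (λ x≡y x≢y → x≢y x≡y) (x∷xs⊆ys (here refl))) ⟩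
    length ys                          ∎
    where
    open ≤-Reasoning
    ≢x? : Decidable (x ≢_)
    ≢x? y = ¬? (x ≟ y)
    xs⊆ys-x : xs ⊆ filter ≢x? ys
    xs⊆ys-x y∈xs = ∈-filter⁺ ≢x? (x∷xs⊆ys (there y∈xs)) (All.lookup x∉xs y∈xs)

length-concatMap-≤ : ∀ {A B : Set} (f : A → List B) {c} (xs : List A) →
                     (∀ {x} → x ∈ xs → length (f x) ≤ c) → length (concatMap f xs) ≤ length xs * c
length-concatMap-≤ f [] _ = z≤n
length-concatMap-≤ f (x ∷ xs) bound = begin
  length (f x ++ concatMap f xs)          ≡⟨ Listₚ.length-++ (f x) ⟩
  length (f x) + length (concatMap f xs)  ≤⟨ +-mono-≤ (bound (here refl)) (length-concatMap-≤ f xs (bound ∘ there)) ⟩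
  _                                       ∎
  where open ≤-Reasoning

length-filter-map : ∀ {A B : Set} {ℓ} {P : Pred B ℓ} (P? : Decidable P) (f : A → B) (xs : List A) →
                    length (filter (P? ∘ f) xs) ≡ length (filter P? (map f xs))
length-filter-map P? f [] = refl
length-filter-map P? f (x ∷ xs) with does (P? (f x))
... | true  = cong suc (length-filter-map P? f xs)
... | false = length-filter-map P? f xs

lastOf : ∀ {A : Set} → A → List A → A
lastOf x []       = x
lastOf _ (y ∷ ys) = lastOf y ys

last-∷ : ∀ {A : Set} (x : A) ys → last (x ∷ ys) ≡ just (lastOf x ys)
last-∷ x []       = refl
last-∷ x (y ∷ ys) = last-∷ y ys

module _ {A : Set} where

  last-tabulate : ∀ {n} (f : Fin (suc n) → A) → last (tabulate f) ≡ just (f (fromℕ n))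
  last-tabulate {zero}  f = refl
  last-tabulate {suc n} f = last-tabulate (f ∘ Fin.suc)

  consecutive-tabulate : ∀ {n} (f : Fin (suc n) → A) (j : Fin n) →
                         (f (inject₁ j) , f (Fin.suc j)) ∈ consecutive (tabulate f)
  consecutive-tabulate {suc n} f Fin.zero    = here refl
  consecutive-tabulate {suc n} f (Fin.suc j) = there (consecutive-tabulate (f ∘ Fin.suc) j)

module _ {A : Set} (m : A) (as bs cs : List A) where

  length-swap-loops : length ((bs ++ m ∷ as) ++ cs) < length (m ∷ as ++ m ∷ bs ++ m ∷ cs)
  length-swap-loops = ≤-trans (n≤1+n _) (≤-reflexive (begin
    suc (suc (length ((bs ++ m ∷ as) ++ cs)))
      ≡⟨ cong (suc ∘ suc) (trans (Listₚ.length-++ (bs ++ m ∷ as)) (cong (_+ length cs) (Listₚ.length-++ bs))) ⟩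
    suc (suc (length bs + suc (length as) + length cs))
      ≡⟨ arith (length as) (length bs) (length cs) ⟩
    suc (length as + suc (length bs + suc (length cs)))
      ≡⟨ cong suc (sym (trans (Listₚ.length-++ as) (cong (λ n → length as + suc n) (Listₚ.length-++ bs)))) ⟩
    length (m ∷ as ++ m ∷ bs ++ m ∷ cs) ∎))
    where
    open ≡-Reasoning
    arith : ∀ a b c → suc (suc (b + suc a + c)) ≡ suc (a + suc (b + suc c))
    arith = solve-∀

  ⊆-swap-loops : m ∷ as ++ m ∷ bs ++ m ∷ cs ⊆ (bs ++ m ∷ as) ++ cs
  ⊆-swap-loops (here refl) = ∈-++⁺ˡ (∈-++⁺ʳ bs (here refl))
  ⊆-swap-loops (there x∈) with ∈-++⁻ as x∈
  ... | inj₁ x∈as = ∈-++⁺ˡ (∈-++⁺ʳ bs (there x∈as))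
  ... | inj₂ (here refl) = ∈-++⁺ˡ (∈-++⁺ʳ bs (here refl))
  ... | inj₂ (there x∈′) with ∈-++⁻ bs x∈′
  ...   | inj₁ x∈bs = ∈-++⁺ˡ (∈-++⁺ˡ x∈bs)
  ...   | inj₂ (here refl) = ∈-++⁺ˡ (∈-++⁺ʳ bs (here refl))
  ...   | inj₂ (there x∈cs) = ∈-++⁺ʳ (bs ++ m ∷ as) x∈cs

count : ℕ → List ℕ → ℕ
count m = length ∘ filter (_≟ m)

count-∷-≡ : ∀ {m b} bs → b ≡ m → count m (b ∷ bs) ≡ suc (count m bs)
count-∷-≡ {m} _ b≡m = cong length (Listₚ.filter-accept (_≟ m) b≡m)

count-∷-≢ : ∀ {m b} bs → b ≢ m → count m (b ∷ bs) ≡ count m bs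
count-∷-≢ {m} _ b≢m = cong length (Listₚ.filter-reject (_≟ m) b≢m)

bitVectors : ∀ n → List (Vec Bool n)
bitVectors zero    = Vec.[] ∷ []
bitVectors (suc n) = map (true Vec.∷_) (bitVectors n) ++ map (false Vec.∷_) (bitVectors n)

length-bitVectors : ∀ n → length (bitVectors n) ≡ 2 ^ n
length-map-++-map : ∀ {A : Set} n (f g : Vec Bool n → A) →
                    length (map f (bitVectors n) ++ map g (bitVectors n)) ≡ 2 ^ suc n

length-bitVectors zero    = refl
length-bitVectors (suc n) = length-map-++-map n (true Vec.∷_) (false Vec.∷_)

length-map-++-map n f g = begin
  length (map f (bitVectors n) ++ map g (bitVectors n))
    ≡⟨ Listₚ.length-++ (map f (bitVectors n)) ⟩
  length (map f (bitVectors n)) + length (map g (bitVectors n))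
    ≡⟨ cong₂ _+_ (Listₚ.length-map f (bitVectors n)) (Listₚ.length-map g (bitVectors n)) ⟩
  length (bitVectors n) + length (bitVectors n)
    ≡⟨ cong₂ _+_ (length-bitVectors n) (trans (length-bitVectors n) (sym (+-identityʳ (2 ^ n)))) ⟩
  2 ^ suc n ∎
  where open ≡-Reasoning

∈-bitVectors : ∀ {n} (v : Vec Bool n) → v ∈ bitVectors n
∈-bitVectors Vec.[] = here refl
∈-bitVectors {suc n} (true Vec.∷ v)  = ∈-++⁺ˡ (∈-map⁺ (true Vec.∷_) (∈-bitVectors v))
∈-bitVectors {suc n} (false Vec.∷ v) = ∈-++⁺ʳ (map (true Vec.∷_) (bitVectors n)) (∈-map⁺ (false Vec.∷_) (∈-bitVectors v))

bitVectors-unique : ∀ n → Unique (bitVectors n)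
bitVectors-unique zero = [] ∷ []
bitVectors-unique (suc n) =
  Uniqueₚ.++⁺ (Uniqueₚ.map⁺ Vecₚ.∷-injectiveʳ (bitVectors-unique n))
              (Uniqueₚ.map⁺ Vecₚ.∷-injectiveʳ (bitVectors-unique n))
              heads-differ
  where
  heads-differ : Disjoint (map (true Vec.∷_) (bitVectors n)) (map (false Vec.∷_) (bitVectors n))
  heads-differ (v∈₁ , v∈₂) with ∈-map⁻ (true Vec.∷_) v∈₁ | ∈-map⁻ (false Vec.∷_) v∈₂
  ... | _ , _ , refl | _ , _ , ()

module _ {n : ℕ} where

  lookup-ext : {s t : Vec Bool n} → (∀ p → lookup s p ≡ lookup t p) → s ≡ t
  lookup-ext h = Pointwise-≡⇒≡ (ext h)

  SameOrDiffersAt : ℕ → Vec Bool n → Vec Bool n → Set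
  SameOrDiffersAt b s s′ = s′ ≡ s ⊎ DiffersExactlyAt s s′ b

  SameOrDiffersAt-sym : ∀ {b s s′} → SameOrDiffersAt b s s′ → SameOrDiffersAt b s′ s
  SameOrDiffersAt-sym (inj₁ refl) = inj₁ refl
  SameOrDiffersAt-sym (inj₂ d) = inj₂ λ p → (λ p≡b eq → proj₁ (d p) p≡b (sym eq)) , (λ p≢b → sym (proj₂ (d p) p≢b))

  SameOrDiffersAt-bit : ∀ {b s s′} → SameOrDiffersAt b s s′ → ∀ p → lookup s p ≢ lookup s′ p → suc (toℕ p) ≡ b
  SameOrDiffersAt-bit (inj₁ refl) p ne = ⊥-elim (ne refl)
  SameOrDiffersAt-bit {b} (inj₂ d) p ne with suc (toℕ p) ≟ b
  ... | yes p≡b = p≡b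
  ... | no p≢b  = ⊥-elim (ne (proj₂ (d p) p≢b))

  copyBit : ℕ → Vec Bool n → Vec Bool n → Vec Bool n
  copyBit b t s = Vec.tabulate λ p → if suc (toℕ p) ≡ᵇ b then lookup t p else lookup s p

  lookup-copyBit-≡ : ∀ b t s p → suc (toℕ p) ≡ b → lookup (copyBit b t s) p ≡ lookup t p
  lookup-copyBit-≡ b t s p p≡b rewrite Vecₚ.lookup∘tabulate (λ p → if suc (toℕ p) ≡ᵇ b then lookup t p else lookup s p) p
    with suc (toℕ p) ≡ᵇ b in eq
  ... | true  = refl
  ... | false = ⊥-elim (subst T eq (≡⇒≡ᵇ _ _ p≡b))

  lookup-copyBit-≢ : ∀ b t s p → suc (toℕ p) ≢ b → lookup (copyBit b t s) p ≡ lookup s p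
  lookup-copyBit-≢ b t s p p≢b rewrite Vecₚ.lookup∘tabulate (λ p → if suc (toℕ p) ≡ᵇ b then lookup t p else lookup s p) p
    with suc (toℕ p) ≡ᵇ b in eq
  ... | true  = ⊥-elim (p≢b (≡ᵇ⇒≡ _ _ (subst T (sym eq) _)))
  ... | false = refl

  copyBit-SameOrDiffersAt : ∀ b t s → SameOrDiffersAt b s (copyBit b t s)
  copyBit-SameOrDiffersAt b t s with Vecₚ.≡-dec Boolₚ._≟_ (copyBit b t s) s
  ... | yes same = inj₁ same
  ... | no differ = inj₂ λ p → (λ p≡b agree → differ (lookup-ext (agreeing p p≡b (sym agree)))) , (λ p≢b → sym (lookup-copyBit-≢ b t s p p≢b))
    where
    agreeing : ∀ p → suc (toℕ p) ≡ b → lookup (copyBit b t s) p ≡ lookup s p → ∀ p′ → lookup (copyBit b t s) p′ ≡ lookup s p′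
    agreeing p p≡b agree p′ with suc (toℕ p′) ≟ b
    ... | no p′≢b = lookup-copyBit-≢ b t s p′ p′≢b
    ... | yes p′≡b with Finₚ.toℕ-injective (suc-injective (trans p′≡b (sym p≡b)))
    ...   | refl = agree

  flipBit : ℕ → Vec Bool n → Vec Bool n
  flipBit b s = copyBit b (Vec.map not s) s

  lookup-flipBit-≡ : ∀ b s p → suc (toℕ p) ≡ b → lookup (flipBit b s) p ≡ not (lookup s p)
  lookup-flipBit-≡ b s p p≡b = trans (lookup-copyBit-≡ b (Vec.map not s) s p p≡b) (Vecₚ.lookup-map p not s)

  flipBit-involutive : ∀ b s → flipBit b (flipBit b s) ≡ s
  flipBit-involutive b s = lookup-ext λ p → pointwise p (suc (toℕ p) ≟ b)
    where
    pointwise : ∀ p → Dec (suc (toℕ p) ≡ b) → lookup (flipBit b (flipBit b s)) p ≡ lookup s p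
    pointwise p (yes p≡b) = trans (lookup-flipBit-≡ b (flipBit b s) p p≡b) (trans (cong not (lookup-flipBit-≡ b s p p≡b)) (Boolₚ.not-involutive _))
    pointwise p (no p≢b)  = trans (lookup-copyBit-≢ b (Vec.map not (flipBit b s)) (flipBit b s) p p≢b) (lookup-copyBit-≢ b (Vec.map not s) s p p≢b)

  DiffersExactlyAt⇒flipBit : ∀ {b s s′} → DiffersExactlyAt s s′ b → s′ ≡ flipBit b s
  DiffersExactlyAt⇒flipBit {b} {s} {s′} d = lookup-ext λ p → pointwise p (suc (toℕ p) ≟ b)
    where
    pointwise : ∀ p → Dec (suc (toℕ p) ≡ b) → lookup s′ p ≡ lookup (flipBit b s) p
    pointwise p (yes p≡b) = trans (Boolₚ.¬-not (proj₁ (d p) p≡b ∘ sym)) (sym (lookup-flipBit-≡ b s p p≡b))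
    pointwise p (no p≢b)  = trans (sym (proj₂ (d p) p≢b)) (sym (lookup-copyBit-≢ b (Vec.map not s) s p p≢b))

  flipBit-≢ : ∀ b s p → suc (toℕ p) ≡ b → flipBit b s ≢ s
  flipBit-≢ b s p p≡b same = Boolₚ.not-¬ refl (trans (sym (cong (λ v → lookup v p) same)) (lookup-flipBit-≡ b s p p≡b))

module Benes (r : ℕ) where

  R : ℕ
  R = 2 * r

  r≤R : r ≤ R
  r≤R = m≤m+n r (r + 0)

  R∸r≡r : R ∸ r ≡ r
  R∸r≡r = trans (m+n∸m≡n r (r + 0)) (+-identityʳ r)

  bitIndex-≤ : ∀ {i} → i ≤ r → bitIndex r i ≡ i
  bitIndex-≤ {i} i≤r with i ≤ᵇ r | ≤ᵇ-reflects-≤ i r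
  ... | true  | _      = refl
  ... | false | ofⁿ i≰r = ⊥-elim (i≰r i≤r)

  bitIndex-> : ∀ {i} → r < i → bitIndex r i ≡ suc R ∸ i
  bitIndex-> {i} r<i with i ≤ᵇ r | ≤ᵇ-reflects-≤ i r
  ... | true  | ofʸ i≤r = ⊥-elim (<⇒≱ r<i i≤r)
  ... | false | _       = cong (_∸ i) (+-comm R 1)

  bitIndex-mirror : ∀ {i} → i ≤ R → bitIndex r (suc R ∸ i) ≡ bitIndex r i
  bitIndex-mirror {i} i≤R with ≤-<-connex i r
  ... | inj₁ i≤r = trans (bitIndex-> r<mirror) (trans (m∸[m∸n]≡n (m≤n⇒m≤1+n i≤R)) (sym (bitIndex-≤ i≤r)))
    where
    r<mirror : r < suc R ∸ i
    r<mirror = ≤-trans (≤-reflexive (cong suc (sym R∸r≡r))) (≤-trans (≤-reflexive (sym (+-∸-assoc 1 r≤R))) (∸-monoʳ-≤ (suc R) i≤r))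
  ... | inj₂ r<i = trans (bitIndex-≤ mirror≤r) (sym (bitIndex-> r<i))
    where
    mirror≤r : suc R ∸ i ≤ r
    mirror≤r = ≤-trans (∸-monoʳ-≤ (suc R) r<i) (≤-reflexive R∸r≡r)

  -- Level walks

  -- A move between adjacent levels of BN(r); it can flip only the bit of its upper level.
  data Step (x y : ℕ) : Set where
    up   : y ≡ suc x → y ≤ R → Step x y
    down : x ≡ suc y → x ≤ R → Step x y

  bitOf : ∀ {x y} → Step x y → ℕ
  bitOf {y = y} (up _ _)   = bitIndex r y
  bitOf {x = x} (down _ _) = bitIndex r x

  target≤R : ∀ {x y} → Step x y → y ≤ R
  target≤R (up _ y≤R)      = y≤R
  target≤R (down refl x≤R) = ≤-trans (n≤1+n _) x≤R

  LevelWalk : ℕ → ℕ → Set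
  LevelWalk = Star Step

  bits : ∀ {x y} → LevelWalk x y → List ℕ
  bits ε       = []
  bits (s ◅ p) = bitOf s ∷ bits p

  bits-◅◅ : ∀ {x y z} (p : LevelWalk x y) (q : LevelWalk y z) → bits (p ◅◅ q) ≡ bits p ++ bits q
  bits-◅◅ ε       q = refl
  bits-◅◅ (s ◅ p) q = cong (bitOf s ∷_) (bits-◅◅ p q)

  target≤source+length : ∀ {x y} (p : LevelWalk x y) → y ≤ x + length (bits p)
  target≤source+length {x} ε = ≤-reflexive (sym (+-identityʳ x))
  target≤source+length {x} (up refl _ ◅ p) =
    ≤-trans (target≤source+length p) (≤-reflexive (sym (+-suc x (length (bits p)))))
  target≤source+length (down refl _ ◅ p) =
    ≤-trans (target≤source+length p) (+-mono-≤ (n≤1+n _) (n≤1+n _))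

  mirrorStep : ∀ {x y} → Step x y → Step (R ∸ x) (R ∸ y)
  mirrorStep {x}     (up refl y≤R)   = down (+-∸-assoc 1 y≤R) (m∸n≤m R x)
  mirrorStep {y = y} (down refl x≤R) = up (+-∸-assoc 1 x≤R) (m∸n≤m R y)

  bitOf-mirrorStep : ∀ {x y} (s : Step x y) → bitOf (mirrorStep s) ≡ bitOf s
  bitOf-mirrorStep (up refl y≤R)   = bitIndex-mirror y≤R
  bitOf-mirrorStep (down refl x≤R) = bitIndex-mirror x≤R

  mirror : ∀ {x y} → LevelWalk x y → LevelWalk (R ∸ x) (R ∸ y)
  mirror = gmap (R ∸_) mirrorStep

  bits-mirror : ∀ {x y} (p : LevelWalk x y) → bits (mirror p) ≡ bits p
  bits-mirror ε       = refl
  bits-mirror (s ◅ p) = cong₂ _∷_ (bitOf-mirrorStep s) (bits-mirror p)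

  Shorter : ∀ {x z} → LevelWalk x z → Set
  Shorter {x} {z} p = Σ[ τ ∈ LevelWalk x z ] length (bits τ) < length (bits p) × bits p ⊆ bits τ

  shorter-◅◅ : ∀ {x y z} (A : LevelWalk x y) {p : LevelWalk y z} → Shorter p → Shorter (A ◅◅ p)
  shorter-◅◅ A {p} (τ , τ<p , p⊆τ) = A ◅◅ τ , shorter , covered
    where
    shorter : length (bits (A ◅◅ τ)) < length (bits (A ◅◅ p))
    shorter rewrite bits-◅◅ A τ | bits-◅◅ A p | Listₚ.length-++ (bits A) {bits τ} | Listₚ.length-++ (bits A) {bits p} =
      +-monoʳ-< (length (bits A)) τ<p
    covered : bits (A ◅◅ p) ⊆ bits (A ◅◅ τ)
    covered rewrite bits-◅◅ A τ | bits-◅◅ A p = ++⁺ʳ (bits A) p⊆τ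

  -- Bit m = m₀ + 1 is carried exactly by the two layers m₀|m and q|q+1 with q = 2r - m; they cut the
  -- levels into a low zone [0, m₀], a middle zone [m, q] and a high zone [q+1, 2r].
  module Gate (m₀ : ℕ) (m≤r : suc m₀ ≤ r) where

    m q : ℕ
    m = suc m₀
    q = R ∸ m

    m≤R : m ≤ R
    m≤R = ≤-trans m≤r r≤R

    r≤q : r ≤ q
    r≤q = ≤-trans (≤-reflexive (sym R∸r≡r)) (∸-monoʳ-≤ R m≤r)

    m≤q : m ≤ q
    m≤q = ≤-trans m≤r r≤q

    bitIndex-m : bitIndex r m ≡ m
    bitIndex-m = bitIndex-≤ m≤r

    bitIndex-1+q : bitIndex r (suc q) ≡ m
    bitIndex-1+q = trans (bitIndex-> (s≤s r≤q)) (m∸[m∸n]≡n m≤R)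

    layer-of-bit : ∀ {x} → suc x ≤ R → bitIndex r (suc x) ≡ m → x ≡ m₀ ⊎ x ≡ q
    layer-of-bit {x} 1+x≤R bit≡m with ≤-<-connex (suc x) r
    ... | inj₁ 1+x≤r = inj₁ (suc-injective (trans (sym (bitIndex-≤ 1+x≤r)) bit≡m))
    ... | inj₂ r<1+x = inj₂ (trans (sym (m∸[m∸n]≡n (≤-trans (n≤1+n x) 1+x≤R)))
                                   (cong (R ∸_) (trans (sym (bitIndex-> r<1+x)) bit≡m)))

    R∸m₀≡1+q : R ∸ m₀ ≡ suc q
    R∸m₀≡1+q = +-∸-assoc 1 m≤R

    R∸[1+q]≡m₀ : R ∸ suc q ≡ m₀
    R∸[1+q]≡m₀ = trans (cong (R ∸_) (sym R∸m₀≡1+q)) (m∸[m∸n]≡n (≤-trans (n≤1+n m₀) m≤R))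

    data Zone : Set where
      low mid high : Zone

    data InZone : Zone → ℕ → Set where
      in-low  : ∀ {x} → x < m → InZone low x
      in-mid  : ∀ {x} → m ≤ x → x ≤ q → InZone mid x
      in-high : ∀ {x} → q < x → InZone high x

    zone-unique : ∀ {z z′ x} → InZone z x → InZone z′ x → z ≡ z′
    zone-unique (in-low _)       (in-low _)      = refl
    zone-unique (in-mid _ _)     (in-mid _ _)    = refl
    zone-unique (in-high _)      (in-high _)     = refl
    zone-unique (in-low x<m)     (in-mid m≤x _)  = ⊥-elim (<⇒≱ x<m m≤x)
    zone-unique (in-low x<m)     (in-high q<x)   = ⊥-elim (<-asym x<m (≤-<-trans m≤q q<x))
    zone-unique (in-mid _ x≤q)   (in-high q<x)   = ⊥-elim (<⇒≱ q<x x≤q)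
    zone-unique z@(in-mid _ _)   z′@(in-low _)   = sym (zone-unique z′ z)
    zone-unique z@(in-high _)    z′@(in-low _)   = sym (zone-unique z′ z)
    zone-unique z@(in-high _)    z′@(in-mid _ _) = sym (zone-unique z′ z)

    step-preserves-zone : ∀ {x y z} (s : Step x y) → bitOf s ≢ m → InZone z x → InZone z y
    step-preserves-zone (up refl _) bit≢m (in-low x<m) with m≤n⇒m<n∨m≡n x<m
    ... | inj₁ 1+x<m = in-low 1+x<m
    ... | inj₂ 1+x≡m = ⊥-elim (bit≢m (trans (cong (bitIndex r) 1+x≡m) bitIndex-m))
    step-preserves-zone (up refl _) bit≢m (in-mid m≤x x≤q) with m≤n⇒m<n∨m≡n x≤q
    ... | inj₁ x<q = in-mid (m≤n⇒m≤1+n m≤x) x<q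
    ... | inj₂ refl = ⊥-elim (bit≢m bitIndex-1+q)
    step-preserves-zone (up refl _) _ (in-high q<x) = in-high (m≤n⇒m≤1+n q<x)
    step-preserves-zone (down refl _) _ (in-low x<m) = in-low (<-trans (n<1+n _) x<m)
    step-preserves-zone (down refl _) bit≢m (in-mid m≤x x≤q) with m≤n⇒m<n∨m≡n m≤x
    ... | inj₁ m<x = in-mid (s≤s⁻¹ m<x) (≤-trans (n≤1+n _) x≤q)
    ... | inj₂ m≡x = ⊥-elim (bit≢m (trans (cong (bitIndex r) (sym m≡x)) bitIndex-m))
    step-preserves-zone (down refl _) bit≢m (in-high q<x) with m≤n⇒m<n∨m≡n (s≤s⁻¹ q<x)
    ... | inj₁ q<y = in-high q<y
    ... | inj₂ refl = ⊥-elim (bit≢m bitIndex-1+q)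

    avoiding-walk-preserves-zone : ∀ {x y z} (p : LevelWalk x y) → All (_≢ m) (bits p) → InZone z x → InZone z y
    avoiding-walk-preserves-zone ε _ in-z = in-z
    avoiding-walk-preserves-zone (s ◅ p) (bit≢m ∷ avoids) in-z =
      avoiding-walk-preserves-zone p avoids (step-preserves-zone s bit≢m in-z)

    data Crossing : ℕ → ℕ → Zone → Zone → Set where
      lowToMid  : Crossing m₀ m low mid
      midToLow  : Crossing m m₀ mid low
      midToHigh : Crossing q (suc q) mid high
      highToMid : Crossing (suc q) q high mid

    crossing : ∀ {x y} (s : Step x y) → bitOf s ≡ m → ∃₂ (Crossing x y)
    crossing (up refl 1+x≤R) bit≡m with layer-of-bit 1+x≤R bit≡m
    ... | inj₁ refl = -, -, lowToMid
    ... | inj₂ refl = -, -, midToHigh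
    crossing (down refl 1+y≤R) bit≡m with layer-of-bit 1+y≤R bit≡m
    ... | inj₁ refl = -, -, midToLow
    ... | inj₂ refl = -, -, highToMid

    crossing-source : ∀ {x y z z′} → Crossing x y z z′ → InZone z x
    crossing-source lowToMid  = in-low (n<1+n m₀)
    crossing-source midToLow  = in-mid ≤-refl m≤q
    crossing-source midToHigh = in-mid m≤q ≤-refl
    crossing-source highToMid = in-high (n<1+n q)

    crossing-target : ∀ {x y z z′} → Crossing x y z z′ → InZone z′ y
    crossing-target lowToMid  = in-mid ≤-refl m≤q
    crossing-target midToLow  = in-low (n<1+n m₀)
    crossing-target midToHigh = in-high (n<1+n q)
    crossing-target highToMid = in-mid m≤q ≤-refl

    Shortcut : ∀ x d {y a b c} → LevelWalk y a → LevelWalk b c → Set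
    Shortcut x d A B = Σ[ τ ∈ LevelWalk x d ] bits τ ≡ bits B ++ m ∷ bits A

    mirror-loop : ∀ {a a′} → R ∸ a ≡ a′ → (L : LevelWalk a a) → Σ[ L′ ∈ LevelWalk a′ a′ ] bits L′ ≡ bits L
    mirror-loop refl L = mirror L , bits-mirror L

    shortcut-via : ∀ {x c y d a₁ a₂ b₁ b₂} {A : LevelWalk a₁ a₂} {B : LevelWalk b₁ b₂}
                   (B′ : LevelWalk x c) → bits B′ ≡ bits B → (e : Step c y) → bitOf e ≡ m →
                   (A′ : LevelWalk y d) → bits A′ ≡ bits A → Shortcut x d A B
    shortcut-via B′ B′≈B e e≡m A′ A′≈A = B′ ◅◅ e ◅ A′ ,
      trans (bits-◅◅ B′ (e ◅ A′)) (cong₂ _++_ B′≈B (cong₂ _∷_ e≡m A′≈A))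

    -- Of the loops A and B between three consecutive crossings, one stays in the middle zone and
    -- the other in an outer zone; replaying them in the opposite order (the outer loop reflected to
    -- the other outer zone if needed) needs only one crossing.
    shortcut : ∀ {x y a b c d z₁ z₂ z₃ z₄} → Crossing x y z₁ z₂ → Crossing a b z₂ z₃ → Crossing c d z₃ z₄ →
               (e₁ : Step x y) → bitOf e₁ ≡ m → (e₃ : Step c d) → bitOf e₃ ≡ m →
               (A : LevelWalk y a) (B : LevelWalk b c) → Shortcut x d A B
    shortcut lowToMid midToLow lowToMid e₁ b₁ _ _ A B = shortcut-via B refl e₁ b₁ A refl
    shortcut lowToMid midToHigh highToMid e₁ b₁ _ _ A B =
      let B′ , B′≈B = mirror-loop R∸[1+q]≡m₀ B in shortcut-via B′ B′≈B e₁ b₁ A refl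
    shortcut highToMid midToLow lowToMid e₁ b₁ _ _ A B =
      let B′ , B′≈B = mirror-loop R∸m₀≡1+q B in shortcut-via B′ B′≈B e₁ b₁ A refl
    shortcut highToMid midToHigh highToMid e₁ b₁ _ _ A B = shortcut-via B refl e₁ b₁ A refl
    shortcut midToLow lowToMid midToLow _ _ e₃ b₃ A B = shortcut-via B refl e₃ b₃ A refl
    shortcut midToLow lowToMid midToHigh _ _ e₃ b₃ A B =
      let A′ , A′≈A = mirror-loop R∸m₀≡1+q A in shortcut-via B refl e₃ b₃ A′ A′≈A
    shortcut midToHigh highToMid midToHigh _ _ e₃ b₃ A B = shortcut-via B refl e₃ b₃ A refl
    shortcut midToHigh highToMid midToLow _ _ e₃ b₃ A B =
      let A′ , A′≈A = mirror-loop R∸[1+q]≡m₀ A in shortcut-via B refl e₃ b₃ A′ A′≈A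

    three-crossings : ∀ {x y a b c d w} (e₁ : Step x y) (A : LevelWalk y a) (e₂ : Step a b) (B : LevelWalk b c)
                      (e₃ : Step c d) (C : LevelWalk d w) → bitOf e₁ ≡ m → bitOf e₂ ≡ m → bitOf e₃ ≡ m →
                      All (_≢ m) (bits A) → All (_≢ m) (bits B) → Shorter (e₁ ◅ A ◅◅ e₂ ◅ B ◅◅ e₃ ◅ C)
    three-crossings e₁ A e₂ B e₃ C b₁ b₂ b₃ A-avoids B-avoids
      with crossing e₁ b₁ | crossing e₂ b₂ | crossing e₃ b₃
    ... | _ , _ , c₁ | _ , _ , c₂ | _ , _ , c₃
      with zone-unique (avoiding-walk-preserves-zone A A-avoids (crossing-target c₁)) (crossing-source c₂)
         | zone-unique (avoiding-walk-preserves-zone B B-avoids (crossing-target c₂)) (crossing-source c₃)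
    ... | refl | refl with shortcut c₁ c₂ c₃ e₁ b₁ e₃ b₃ A B
    ... | τ , τ≈BA = τ ◅◅ C ,
      subst₂ (λ u v → length u < length v) (sym new-bits) (sym old-bits) (length-swap-loops m (bits A) (bits B) (bits C)) ,
      subst₂ _⊆_ (sym old-bits) (sym new-bits) (⊆-swap-loops m (bits A) (bits B) (bits C))
      where
      new-bits : bits (τ ◅◅ C) ≡ (bits B ++ m ∷ bits A) ++ bits C
      new-bits = trans (bits-◅◅ τ C) (cong (_++ bits C) τ≈BA)
      old-bits : bits (e₁ ◅ A ◅◅ e₂ ◅ B ◅◅ e₃ ◅ C) ≡ m ∷ bits A ++ m ∷ bits B ++ m ∷ bits C
      old-bits = cong₂ _∷_ b₁ (trans (bits-◅◅ A _) (cong (bits A ++_) (cong₂ _∷_ b₂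
                   (trans (bits-◅◅ B _) (cong (bits B ++_) (cong (_∷ bits C) b₃))))))

    record Split (k : ℕ) {x z} (p : LevelWalk x z) : Set where
      constructor split-at
      field
        {a b}  : ℕ
        before : LevelWalk x a
        step   : Step a b
        after  : LevelWalk b z
        before-avoids : All (_≢ m) (bits before)
        step-bit      : bitOf step ≡ m
        after-count   : k ≤ count m (bits after)
        splits        : p ≡ before ◅◅ step ◅ after

    split-first : ∀ {k x z} (p : LevelWalk x z) → suc k ≤ count m (bits p) → Split k p
    split-first (s ◅ p) k<#p with bitOf s ≟ m
    ... | yes s≡m = split-at ε s p [] s≡m (s≤s⁻¹ (subst (_ ≤_) (count-∷-≡ (bits p) s≡m) k<#p)) refl
    ... | no s≢m with split-first p (subst (_ ≤_) (count-∷-≢ (bits p) s≢m) k<#p)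
    ...   | split-at A e rest A-avoids e≡m k≤ refl = split-at (s ◅ A) e rest (s≢m ∷ A-avoids) e≡m k≤ refl

    shorten : ∀ {x z} (p : LevelWalk x z) → 3 ≤ count m (bits p) → Shorter p
    shorten p 3≤#p with split-first p 3≤#p
    ... | split-at A₀ e₁ p₁ _ b₁ 2≤#p₁ refl with split-first p₁ 2≤#p₁
    ... | split-at A e₂ p₂ A-avoids b₂ 1≤#p₂ refl with split-first p₂ 1≤#p₂
    ... | split-at B e₃ C B-avoids b₃ _ refl =
      shorter-◅◅ A₀ (three-crossings e₁ A e₂ B e₃ C b₁ b₂ b₃ A-avoids B-avoids)

  -- Walks of BN(r)

  Vertex : Set
  Vertex = BNVertex r

  level : Vertex → ℕ
  level = toℕ ∘ proj₂

  level≤R : ∀ u → level u ≤ R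
  level≤R u = Finₚ.toℕ≤pred[n] (proj₂ u)

  stepOf : ∀ {u v} → BNAdj r u v → Step (level u) (level v)
  stepOf {v = v} (inj₁ (v-above , _)) = up v-above (level≤R v)
  stepOf {u = u} (inj₂ (u-above , _)) = down u-above (level≤R u)

  project : ∀ u vs → IsWalk r (u ∷ vs) → LevelWalk (level u) (level (lastOf u vs))
  project u []       _         = ε
  project u (v ∷ vs) (u~v , w) = stepOf u~v ◅ project v vs w

  length-bits-project : ∀ u vs (w : IsWalk r (u ∷ vs)) → length (bits (project u vs w)) ≡ length vs
  length-bits-project u []       _       = refl
  length-bits-project u (v ∷ vs) (_ , w) = cong suc (length-bits-project v vs w)

  bitOf-stepOf : ∀ {u v} (u~v : BNAdj r u v) p → lookup (proj₁ u) p ≢ lookup (proj₁ v) p → bitOf (stepOf u~v) ≡ suc (toℕ p)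
  bitOf-stepOf (inj₁ (_ , same-or-differs)) p ne = sym (SameOrDiffersAt-bit same-or-differs p ne)
  bitOf-stepOf (inj₂ (_ , same-or-differs)) p ne = sym (SameOrDiffersAt-bit same-or-differs p (ne ∘ sym))

  project-covers : ∀ u vs (w : IsWalk r (u ∷ vs)) p →
                   lookup (proj₁ u) p ≢ lookup (proj₁ (lastOf u vs)) p → suc (toℕ p) ∈ bits (project u vs w)
  project-covers u [] _ p ne = ⊥-elim (ne refl)
  project-covers u (v ∷ vs) (u~v , w) p ne with lookup (proj₁ u) p Boolₚ.≟ lookup (proj₁ v) p
  ... | no u≢v  = here (sym (bitOf-stepOf u~v p u≢v))
  ... | yes u≡v = there (project-covers v vs w p (ne ∘ trans u≡v))

  module Lift (t : Vec Bool r) where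

    next : ∀ {x y} → Step x y → Vec Bool r → Vertex
    next s v = copyBit (bitOf s) t v , fromℕ< (s≤s (target≤R s))

    level-next : ∀ {x y} (s : Step x y) v → level (next s v) ≡ y
    level-next s v = Finₚ.toℕ-fromℕ< (s≤s (target≤R s))

    lift : ∀ {x y} → LevelWalk x y → Vec Bool r → List Vertex
    lift ε       v = []
    lift (s ◅ p) v = next s v ∷ lift p (proj₁ (next s v))

    length-lift : ∀ {x y} (p : LevelWalk x y) v → length (lift p v) ≡ length (bits p)
    length-lift ε       v = refl
    length-lift (s ◅ p) v = cong suc (length-lift p _)

    next-adjacent : ∀ {x y} (s : Step x y) v i → toℕ i ≡ x → BNAdj r (v , i) (next s v)
    next-adjacent s@(up y≡1+x _) v i i≡x =
      inj₁ (trans (level-next s v) (trans y≡1+x (cong suc (sym i≡x))) ,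
            subst (λ l → SameOrDiffersAt (bitIndex r l) v (copyBit (bitOf s) t v)) (sym (level-next s v)) (copyBit-SameOrDiffersAt _ t v))
    next-adjacent s@(down x≡1+y _) v i i≡x =
      inj₂ (trans i≡x (trans x≡1+y (cong suc (sym (level-next s v)))) ,
            subst (λ l → SameOrDiffersAt (bitIndex r l) (copyBit (bitOf s) t v) v) (sym i≡x) (SameOrDiffersAt-sym (copyBit-SameOrDiffersAt _ t v)))

    lift-walk : ∀ {x y} (p : LevelWalk x y) v i → toℕ i ≡ x → IsWalk r ((v , i) ∷ lift p v)
    lift-walk ε       v i _   = _
    lift-walk (s ◅ p) v i i≡x = next-adjacent s v i i≡x , lift-walk p _ _ (level-next s v)

    level-lift : ∀ {x y} (p : LevelWalk x y) v i → toℕ i ≡ x → level (lastOf (v , i) (lift p v)) ≡ y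
    level-lift ε       v i i≡x = i≡x
    level-lift (s ◅ p) v i _   = level-lift p _ _ (level-next s v)

    vector-lift : ∀ {x y} (p : LevelWalk x y) v i → (∀ j → lookup v j ≢ lookup t j → suc (toℕ j) ∈ bits p) →
                  proj₁ (lastOf (v , i) (lift p v)) ≡ t
    vector-lift ε v i covered = lookup-ext agree
      where
      agree : ∀ j → lookup v j ≡ lookup t j
      agree j with lookup v j Boolₚ.≟ lookup t j
      ... | yes v≡t = v≡t
      ... | no v≢t with covered j v≢t
      ...   | ()
    vector-lift (s ◅ p) v i covered = vector-lift p _ _ covered′
      where
      covered′ : ∀ j → lookup (copyBit (bitOf s) t v) j ≢ lookup t j → suc (toℕ j) ∈ bits p
      covered′ j ne with suc (toℕ j) ≟ bitOf s
      ... | yes j≡b = ⊥-elim (ne (lookup-copyBit-≡ _ t v j j≡b))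
      ... | no j≢b with covered j (ne ∘ trans (lookup-copyBit-≢ _ t v j j≢b))
      ...   | here j≡b  = ⊥-elim (j≢b j≡b)
      ...   | there j∈p = j∈p

  -- Three steps carrying the bit could be shortcut; lifting the shorter level walk, with every bit
  -- it carries copied from the far end, would give a shorter walk between the same vertices.
  gate-count-on-geodesic : ∀ m₀ → suc m₀ ≤ r → ∀ u vs (g : IsGeodesic r (u ∷ vs)) →
                           count (suc m₀) (bits (project u vs (proj₁ g))) ≤ 2
  gate-count-on-geodesic m₀ m≤r (s , i) vs (w , minimal) with 3 ≤? count (suc m₀) (bits (project (s , i) vs w))
  ... | no 3≰# = ≤-pred (≰⇒> 3≰#)
  ... | yes 3≤# with Gate.shorten m₀ m≤r (project (s , i) vs w) 3≤#
  ... | τ , τ<p , p⊆τ = ⊥-elim (<⇒≱ shorter (minimal ((s , i) ∷ lift τ s) (lift-walk τ s i refl) refl same-last))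
    where
    open Lift (proj₁ (lastOf (s , i) vs))
    shorter : walkLength ((s , i) ∷ lift τ s) < walkLength ((s , i) ∷ vs)
    shorter = subst₂ _<_ (sym (length-lift τ s)) (length-bits-project _ vs w) τ<p
    same-last : last ((s , i) ∷ lift τ s) ≡ last ((s , i) ∷ vs)
    same-last = trans (last-∷ _ (lift τ s)) (trans (cong just (cong₂ _,_
      (vector-lift τ s i (λ j ne → p⊆τ (project-covers _ vs w j ne)))
      (Finₚ.toℕ-injective (level-lift τ s i refl)))) (sym (last-∷ _ vs)))

  orient : Vertex → Vertex → Vertex × Vertex
  orient u v with level u <? level v
  ... | yes _ = u , v
  ... | no _  = v , u

  upperBit : Vertex × Vertex → ℕ
  upperBit (_ , v) = bitIndex r (level v)

  orient-upward : ∀ {u v} → level v ≡ suc (level u) → orient u v ≡ (u , v)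
  orient-upward {u} {v} v-above with level u <? level v
  ... | yes _  = refl
  ... | no u≮v = ⊥-elim (u≮v (≤-reflexive (sym v-above)))

  orient-downward : ∀ {u v} → level v ≡ suc (level u) → orient v u ≡ (u , v)
  orient-downward {u} {v} v-above with level v <? level u
  ... | yes v<u = ⊥-elim (<-asym v<u (≤-reflexive (sym v-above)))
  ... | no _    = refl

  bits-project-orient : ∀ u vs (w : IsWalk r (u ∷ vs)) →
                        bits (project u vs w) ≡ map upperBit (map (uncurry orient) (consecutive (u ∷ vs)))
  bits-project-orient u []       _         = refl
  bits-project-orient u (v ∷ vs) (u~v , w) = cong₂ _∷_ (step-bit u~v) (bits-project-orient v vs w)
    where
    step-bit : ∀ {u v} (u~v : BNAdj r u v) → bitOf (stepOf u~v) ≡ upperBit (orient u v)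
    step-bit (inj₁ (v-above , _)) = sym (cong upperBit (orient-upward v-above))
    step-bit (inj₂ (u-above , _)) = sym (cong upperBit (orient-downward u-above))

  edgesOnWalk-≤-count : ∀ {m S} → IsEdgeSet r S → (∀ {e} → e ∈ S → upperBit e ≡ m) →
                        ∀ u vs (w : IsWalk r (u ∷ vs)) → edgesOnWalk r S (u ∷ vs) ≤ count m (bits (project u vs w))
  edgesOnWalk-≤-count {m} {S} (downward , S!) S-bit u vs w = begin
    length (filter (onWalk? r (u ∷ vs)) S)
      ≤⟨ unique-⊆⇒length-≤ (pair-≟ r) (Uniqueₚ.filter⁺ (onWalk? r (u ∷ vs)) S!) on-walk⇒oriented ⟩
    length (filter ((_≟ m) ∘ upperBit) oriented)
      ≡⟨ length-filter-map (_≟ m) upperBit oriented ⟩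
    count m (map upperBit oriented)
      ≡⟨ cong (count m) (sym (bits-project-orient u vs w)) ⟩
    count m (bits (project u vs w)) ∎
    where
    open ≤-Reasoning
    oriented : List (Vertex × Vertex)
    oriented = map (uncurry orient) (consecutive (u ∷ vs))
    oriented-edge : ∀ {a b} → BNDown r a b →
                    (a , b) ∈ consecutive (u ∷ vs) ⊎ (b , a) ∈ consecutive (u ∷ vs) → (a , b) ∈ oriented
    oriented-edge (b-above , _) (inj₁ ∈P) = subst (_∈ oriented) (orient-upward b-above) (∈-map⁺ (uncurry orient) ∈P)
    oriented-edge (b-above , _) (inj₂ ∈P) = subst (_∈ oriented) (orient-downward b-above) (∈-map⁺ (uncurry orient) ∈P)
    on-walk⇒oriented : filter (onWalk? r (u ∷ vs)) S ⊆ filter ((_≟ m) ∘ upperBit) oriented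
    on-walk⇒oriented e∈ with ∈-filter⁻ (onWalk? r (u ∷ vs)) e∈
    ... | e∈S , on-walk = ∈-filter⁺ ((_≟ m) ∘ upperBit) (oriented-edge (All.lookup downward e∈S) on-walk) (S-bit e∈S)

  -- Covering BN(r) by geodesics

  tabulate-walk : ∀ {n} (f : Fin (suc n) → Vertex) → (∀ j → BNAdj r (f (inject₁ j)) (f (Fin.suc j))) → IsWalk r (tabulate f)
  tabulate-walk {zero}  f _   = _
  tabulate-walk {suc n} f adj = adj Fin.zero , tabulate-walk (f ∘ Fin.suc) (adj ∘ Fin.suc)

  vertexAt : (ℕ → Vec Bool r) → Fin (suc R) → Vertex
  vertexAt f j = f (toℕ j) , j

  ascent : (ℕ → Vec Bool r) → List Vertex
  ascent f = tabulate (vertexAt f)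

  ascent-step : ∀ f (j : Fin R) → ((f (toℕ j) , inject₁ j) , (f (suc (toℕ j)) , Fin.suc j)) ∈ consecutive (ascent f)
  ascent-step f j = subst (λ l → ((f l , inject₁ j) , (f (suc (toℕ j)) , Fin.suc j)) ∈ consecutive (ascent f))
                          (Finₚ.toℕ-inject₁ j) (consecutive-tabulate (vertexAt f) j)

  ascent-geodesic : ∀ f → (∀ l → l < R → SameOrDiffersAt (bitIndex r (suc l)) (f l) (f (suc l))) → IsGeodesic r (ascent f)
  ascent-geodesic f f-steps = tabulate-walk (vertexAt f) adjacent , minimal
    where
    adjacent : ∀ (j : Fin R) → BNAdj r (f (toℕ (inject₁ j)) , inject₁ j) (f (suc (toℕ j)) , Fin.suc j)
    adjacent j = inj₁ (cong suc (sym (Finₚ.toℕ-inject₁ j)) ,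
      subst (λ l → SameOrDiffersAt (bitIndex r (suc (toℕ j))) (f l) (f (suc (toℕ j)))) (sym (Finₚ.toℕ-inject₁ j))
            (f-steps (toℕ j) (Finₚ.toℕ<n j)))
    minimal : ∀ Q → IsWalk r Q → head Q ≡ head (ascent f) → last Q ≡ last (ascent f) → walkLength (ascent f) ≤ walkLength Q
    minimal (q ∷ qs) w q-first q-last = begin
      walkLength (ascent f)                     ≡⟨ cong (_∸ 1) (Listₚ.length-tabulate (vertexAt f)) ⟩
      R                                         ≡⟨ sym level-last ⟩
      level (lastOf q qs)                       ≤⟨ target≤source+length (project q qs w) ⟩
      level q + length (bits (project q qs w))  ≡⟨ cong₂ _+_ level-first (length-bits-project q qs w) ⟩
      length qs                                 ∎
      where
      open ≤-Reasoning
      level-first : level q ≡ 0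
      level-first = cong level (Maybeₚ.just-injective q-first)
      level-last : level (lastOf q qs) ≡ R
      level-last = trans (cong level (Maybeₚ.just-injective (trans (sym (last-∷ q qs)) (trans q-last (last-tabulate (vertexAt f))))))
                         (Finₚ.toℕ-fromℕ R)

  crossVector : Vec Bool r → ℕ → Vec Bool r
  crossVector v zero    = v
  crossVector v (suc l) = flipBit (bitIndex r (suc l)) (crossVector v l)

  crossStart : ℕ → Vec Bool r → Vec Bool r
  crossStart zero    a = a
  crossStart (suc l) a = crossStart l (flipBit (bitIndex r (suc l)) a)

  crossVector-crossStart : ∀ l a → crossVector (crossStart l a) l ≡ a
  crossVector-crossStart zero    a = refl
  crossVector-crossStart (suc l) a =
    trans (cong (flipBit b) (crossVector-crossStart l (flipBit b a))) (flipBit-involutive b a)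
    where b = bitIndex r (suc l)

  straightAscent crossAscent : Vec Bool r → List Vertex
  straightAscent v = ascent λ _ → v
  crossAscent    v = ascent (crossVector v)

  ascents : List (List Vertex)
  ascents = map straightAscent (bitVectors r) ++ map crossAscent (bitVectors r)

  length-ascents : length ascents ≡ 2 ^ (r + 1)
  length-ascents = trans (length-map-++-map r _ _) (cong (2 ^_) (+-comm 1 r))

  ascents-geodesic : ∀ {P} → P ∈ ascents → IsGeodesic r P
  ascents-geodesic P∈ with ∈-++⁻ (map straightAscent (bitVectors r)) P∈
  ... | inj₁ P∈straight with ∈-map⁻ straightAscent P∈straight
  ...   | v , _ , refl = ascent-geodesic (λ _ → v) (λ _ _ → inj₁ refl)
  ascents-geodesic P∈ | inj₂ P∈cross with ∈-map⁻ crossAscent P∈cross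
  ...   | v , _ , refl = ascent-geodesic (crossVector v) λ l _ →
                           copyBit-SameOrDiffersAt (bitIndex r (suc l)) (Vec.map not (crossVector v l)) (crossVector v l)

  edge-on-ascent : ∀ {u v} → BNDown r u v → Σ[ P ∈ List Vertex ] P ∈ ascents × (u , v) ∈ consecutive P
  edge-on-ascent {a , i} {b , Fin.suc j} (v-above , same-or-differs)
    with Finₚ.toℕ-injective (trans (Finₚ.toℕ-inject₁ j) (suc-injective v-above))
  edge-on-ascent {a , _} {b , Fin.suc j} (_ , inj₁ refl) | refl =
    straightAscent a , ∈-++⁺ˡ (∈-map⁺ straightAscent (∈-bitVectors a)) , ascent-step (λ _ → a) j
  edge-on-ascent {a , _} {b , Fin.suc j} (_ , inj₂ differs) | refl with DiffersExactlyAt⇒flipBit {s = a} {s′ = b} differs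
  ... | refl = crossAscent start ,
               ∈-++⁺ʳ (map straightAscent (bitVectors r)) (∈-map⁺ crossAscent (∈-bitVectors start)) ,
               subst (λ x → ((x , inject₁ j) , (flipBit (bitIndex r (suc (toℕ j))) x , Fin.suc j)) ∈ consecutive (crossAscent start))
                     (crossVector-crossStart (toℕ j) a) (ascent-step (crossVector start) j)
    where start = crossStart (toℕ j) a

  edgeGP-length-≤ : ∀ k S → IsEdgeGP r k S → length S ≤ (k ∸ 1) * 2 ^ (r + 1)
  edgeGP-length-≤ k S ((downward , S!) , gp) = begin
    length S                             ≤⟨ unique-⊆⇒length-≤ (pair-≟ r) S! covered ⟩
    length (concatMap on ascents)        ≤⟨ length-concatMap-≤ on ascents (λ P∈ → gp _ (ascents-geodesic P∈)) ⟩
    length ascents * (k ∸ 1)             ≡⟨ cong (_* (k ∸ 1)) length-ascents ⟩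
    2 ^ (r + 1) * (k ∸ 1)                ≡⟨ *-comm (2 ^ (r + 1)) (k ∸ 1) ⟩
    (k ∸ 1) * 2 ^ (r + 1)                ∎
    where
    open ≤-Reasoning
    on : List Vertex → List (Vertex × Vertex)
    on P = filter (onWalk? r P) S
    covered : S ⊆ concatMap on ascents
    covered e∈S with edge-on-ascent (All.lookup downward e∈S)
    ... | P , P∈ , e∈P = ∈-concat⁺′ (∈-filter⁺ (onWalk? r P) e∈S (inj₁ e∈P)) (∈-map⁺ on P∈)

  -- Edge sets of gates

  edgesOnWalk-++ : ∀ S S′ P → edgesOnWalk r (S ++ S′) P ≡ edgesOnWalk r S P + edgesOnWalk r S′ P
  edgesOnWalk-++ S S′ P =
    trans (cong length (Listₚ.filter-++ (onWalk? r P) S S′)) (Listₚ.length-++ (filter (onWalk? r P) S))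

  straightEdge crossEdge : Fin R → Vec Bool r → Vertex × Vertex
  straightEdge l a = (a , inject₁ l) , (a , Fin.suc l)
  crossEdge    l a = (a , inject₁ l) , (flipBit (bitIndex r (suc (toℕ l))) a , Fin.suc l)

  layerEdges : Fin R → List (Vertex × Vertex)
  layerEdges l = map (straightEdge l) (bitVectors r) ++ map (crossEdge l) (bitVectors r)

  length-layerEdges : ∀ l → length (layerEdges l) ≡ 2 ^ (r + 1)
  length-layerEdges l = trans (length-map-++-map r _ _) (cong (2 ^_) (+-comm 1 r))

  ∈-layerEdges : ∀ {l e} → e ∈ layerEdges l → BNDown r (proj₁ e) (proj₂ e) × proj₂ (proj₂ e) ≡ Fin.suc l
  ∈-layerEdges {l} e∈ with ∈-++⁻ (map (straightEdge l) (bitVectors r)) e∈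
  ... | inj₁ e∈straight with ∈-map⁻ (straightEdge l) e∈straight
  ...   | a , _ , refl = (cong suc (sym (Finₚ.toℕ-inject₁ l)) , inj₁ refl) , refl
  ∈-layerEdges {l} e∈ | inj₂ e∈cross with ∈-map⁻ (crossEdge l) e∈cross
  ...   | a , _ , refl = (cong suc (sym (Finₚ.toℕ-inject₁ l)) , copyBit-SameOrDiffersAt _ (Vec.map not a) a) , refl

  layerEdges-unique : ∀ l (p : Fin r) → suc (toℕ p) ≡ bitIndex r (suc (toℕ l)) → Unique (layerEdges l)
  layerEdges-unique l p p-bit =
    Uniqueₚ.++⁺ (Uniqueₚ.map⁺ (cong (proj₁ ∘ proj₁)) (bitVectors-unique r))
                (Uniqueₚ.map⁺ (cong (proj₁ ∘ proj₁)) (bitVectors-unique r))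
                straight∩cross
    where
    straight∩cross : Disjoint (map (straightEdge l) (bitVectors r)) (map (crossEdge l) (bitVectors r))
    straight∩cross (e∈straight , e∈cross) with ∈-map⁻ (straightEdge l) e∈straight | ∈-map⁻ (crossEdge l) e∈cross
    ... | a , _ , refl | b , _ , same =
      flipBit-≢ _ b p p-bit (trans (sym (cong (proj₁ ∘ proj₂) same)) (cong (proj₁ ∘ proj₁) same))

  module GateEdges (m₀ : ℕ) (m≤r : suc m₀ ≤ r) where
    open Gate m₀ m≤r

    lowLayer highLayer : Fin R
    lowLayer  = fromℕ< m≤R
    highLayer = fromℕ< (∸-monoʳ-< (s≤s z≤n) m≤R)

    gateEdges : List (Vertex × Vertex)
    gateEdges = layerEdges lowLayer ++ layerEdges highLayer

    bit-lowLayer : bitIndex r (suc (toℕ lowLayer)) ≡ m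
    bit-lowLayer = trans (cong (bitIndex r ∘ suc) (Finₚ.toℕ-fromℕ< m≤R)) bitIndex-m

    bit-highLayer : bitIndex r (suc (toℕ highLayer)) ≡ m
    bit-highLayer = trans (cong (bitIndex r ∘ suc) (Finₚ.toℕ-fromℕ< _)) bitIndex-1+q

    position : Fin r
    position = fromℕ< m≤r

    suc-position : suc (toℕ position) ≡ m
    suc-position = cong suc (Finₚ.toℕ-fromℕ< m≤r)

    ∈-gateEdges : ∀ {e} → e ∈ gateEdges → BNDown r (proj₁ e) (proj₂ e) × upperBit e ≡ m
    ∈-gateEdges e∈ with ∈-++⁻ (layerEdges lowLayer) e∈
    ... | inj₁ e∈low  = let downward , upper = ∈-layerEdges e∈low in
                        downward , trans (cong (bitIndex r ∘ toℕ) upper) bit-lowLayer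
    ... | inj₂ e∈high = let downward , upper = ∈-layerEdges e∈high in
                        downward , trans (cong (bitIndex r ∘ toℕ) upper) bit-highLayer

    gateEdges-isEdgeSet : IsEdgeSet r gateEdges
    gateEdges-isEdgeSet =
      All.tabulate (proj₁ ∘ ∈-gateEdges) ,
      Uniqueₚ.++⁺ (layerEdges-unique lowLayer position (trans suc-position (sym bit-lowLayer)))
                  (layerEdges-unique highLayer position (trans suc-position (sym bit-highLayer)))
                  low∩high
      where
      low∩high : Disjoint (layerEdges lowLayer) (layerEdges highLayer)
      low∩high (e∈low , e∈high) = <⇒≢ (<-≤-trans (n<1+n m₀) m≤q) layers-equal
        where
        layers-equal : m₀ ≡ q
        layers-equal = trans (sym (Finₚ.toℕ-fromℕ< m≤R))
          (trans (cong toℕ (Finₚ.suc-injective (trans (sym (proj₂ (∈-layerEdges e∈low))) (proj₂ (∈-layerEdges e∈high)))))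
                 (Finₚ.toℕ-fromℕ< _))

    length-gateEdges : length gateEdges ≡ 2 * 2 ^ (r + 1)
    length-gateEdges = begin
      length gateEdges                                                   ≡⟨ Listₚ.length-++ (layerEdges lowLayer) ⟩
      length (layerEdges lowLayer) + length (layerEdges highLayer)       ≡⟨ cong₂ _+_ (length-layerEdges lowLayer) (length-layerEdges highLayer) ⟩
      2 ^ (r + 1) + 2 ^ (r + 1)                                          ≡⟨ cong (2 ^ (r + 1) +_) (sym (+-identityʳ (2 ^ (r + 1)))) ⟩
      2 * 2 ^ (r + 1)                                                    ∎
      where open ≡-Reasoning

    gateEdges-on-geodesic : ∀ P → IsGeodesic r P → edgesOnWalk r gateEdges P ≤ 2
    gateEdges-on-geodesic (u ∷ vs) g =
      ≤-trans (edgesOnWalk-≤-count gateEdges-isEdgeSet (proj₂ ∘ ∈-gateEdges) u vs (proj₁ g))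
              (gate-count-on-geodesic m₀ m≤r u vs g)

  open GateEdges using (gateEdges; ∈-gateEdges; gateEdges-isEdgeSet; length-gateEdges; gateEdges-on-geodesic)

  one-gate-edgeGP : ∀ m₀ (m≤r : suc m₀ ≤ r) → IsEdgeGP r 3 (gateEdges m₀ m≤r) × length (gateEdges m₀ m≤r) ≡ 2 * 2 ^ (r + 1)
  one-gate-edgeGP m₀ m≤r = (gateEdges-isEdgeSet m₀ m≤r , gateEdges-on-geodesic m₀ m≤r) , length-gateEdges m₀ m≤r

  two-gates-edgeGP : ∀ m₀ (m≤r : suc m₀ ≤ r) m₀′ (m′≤r : suc m₀′ ≤ r) → m₀ ≢ m₀′ →
                     let S = gateEdges m₀ m≤r ++ gateEdges m₀′ m′≤r in IsEdgeGP r 5 S × length S ≡ 4 * 2 ^ (r + 1)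
  two-gates-edgeGP m₀ m≤r m₀′ m′≤r m₀≢m₀′ =
    ( ( Allₚ.++⁺ (proj₁ (gateEdges-isEdgeSet m₀ m≤r)) (proj₁ (gateEdges-isEdgeSet m₀′ m′≤r))
      , Uniqueₚ.++⁺ (proj₂ (gateEdges-isEdgeSet m₀ m≤r)) (proj₂ (gateEdges-isEdgeSet m₀′ m′≤r)) gates-disjoint )
    , on-geodesic )
    , trans (Listₚ.length-++ (gateEdges m₀ m≤r))
            (trans (cong₂ _+_ (length-gateEdges m₀ m≤r) (length-gateEdges m₀′ m′≤r)) (sym (*-distribʳ-+ (2 ^ (r + 1)) 2 2)))
    where
    gates-disjoint : Disjoint (gateEdges m₀ m≤r) (gateEdges m₀′ m′≤r)
    gates-disjoint (e∈ , e∈′) = m₀≢m₀′ (suc-injective (trans (sym (proj₂ (∈-gateEdges m₀ m≤r e∈))) (proj₂ (∈-gateEdges m₀′ m′≤r e∈′))))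
    on-geodesic : ∀ P → IsGeodesic r P → edgesOnWalk r (gateEdges m₀ m≤r ++ gateEdges m₀′ m′≤r) P ≤ 4
    on-geodesic P g = ≤-trans (≤-reflexive (edgesOnWalk-++ (gateEdges m₀ m≤r) (gateEdges m₀′ m′≤r) P))
                              (+-mono-≤ (gateEdges-on-geodesic m₀ m≤r P g) (gateEdges-on-geodesic m₀′ m′≤r P g))

theorem5p2 : (r : ℕ) → 3 ≤ r → (k : ℕ) → (k ≡ 3 ⊎ k ≡ 5) →
    EdgeGPNumberIs r k ((k ∸ 1) * 2 ^ (r + 1))
theorem5p2 r 3≤r k k≡3∨5 = extremal k≡3∨5 , edgeGP-length-≤ k
  where
  open Benes r
  1<r : 1 < r
  1<r = ≤-trans (s≤s (s≤s z≤n)) 3≤r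
  gate-r : suc (r ∸ 1) ≤ r
  gate-r = ≤-reflexive (m+[n∸m]≡n (<⇒≤ 1<r))
  extremal : k ≡ 3 ⊎ k ≡ 5 → Σ[ S ∈ List (Vertex × Vertex) ] IsEdgeGP r k S × length S ≡ (k ∸ 1) * 2 ^ (r + 1)
  extremal (inj₁ refl) = -, one-gate-edgeGP (r ∸ 1) gate-r
  extremal (inj₂ refl) = -, two-gates-edgeGP (r ∸ 1) gate-r 0 (<⇒≤ 1<r) (m>n⇒m∸n≢0 1<r)
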